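{- Let $\Pi$ be a projective plane of order $n$ and let $n \geq k \geq 4$. Then $$(n-k+2)(k-1)\,c_{2k-2}(\Gamma_{\Pi}) \leq |A_k(\Gamma_{\Pi})| \leq (n-1)(k-1)\,c_{2k-2}(\Gamma_{\Pi}).$$
   Context: $\Gamma_{\Pi}$ is the Levi graph of $\Pi$: the bipartite graph whose vertex classes are the points and the lines of $\Pi$, a point being adjacent to a line iff it lies on it. $c_{2k-2}(\Gamma_{\Pi})$ is the number of cycles of length $2k-2$ in $\Gamma_{\Pi}$. $A_k(\Gamma_{\Pi})$ is the set of subgraphs $H$ of $\Gamma_{\Pi}$ of the following form: $H$ consists of a cycle $C$ of length $2k-2$ in $\Gamma_{\Pi}$, together with one additional point vertex $P \notin V(C)$ and exactly one additional edge joining $P$ to a line vertex of $C$ (containing $P$). Two such subgraphs are counted as the same iff they have the same vertex set and the same edge set. -}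

module Defs where

open import Data.Bool using (Bool; true; false; _∧_; _∨_; not; T)
import Data.Bool.Properties as BoolP
open import Data.Nat using (ℕ; zero; suc; _≤_)
open import Data.Fin using (Fin)
import Data.Fin as Fin
open import Data.List using (List; []; _∷_; length; filterᵇ; concatMap; map; deduplicate; allFin)
open import Data.Bool.ListAction using (any)
open import Data.Vec using (Vec; []; _∷_; lookup; tabulate; _∷ʳ_)
import Data.Vec.Properties as VecP
import Data.Product.Properties as ProdP
open import Data.Product using (Σ; _×_; _,_)
import Data.Product
open import Relation.Binary.PropositionalEquality using (_≡_; _≢_)
open import Relation.Binary.Definitions using (DecidableEquality)
open import Relation.Nullary.Decidable using (⌊_⌋)

Incidence : ℕ → ℕ → Set
Incidence p l = Fin p → Fin l → Bool

_==ᶠ_ : ∀ {m} → Fin m → Fin m → Bool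
x ==ᶠ y = ⌊ x Fin.≟ y ⌋

pointsOn : ∀ {p l} → Incidence p l → Fin l → ℕ
pointsOn {p} I L = length (filterᵇ (λ x → I x L) (allFin p))

record IsProjectivePlane {p l : ℕ} (n : ℕ) (I : Incidence p l) : Set where
  field
    two-points : ∀ (x y : Fin p) → x ≢ y →
      Σ (Fin l) λ L → (T (I x L) × T (I y L)) ×
        (∀ (L′ : Fin l) → T (I x L′) → T (I y L′) → L′ ≡ L)
    two-lines : ∀ (L M : Fin l) → L ≢ M →
      Σ (Fin p) λ x → (T (I x L) × T (I x M)) ×
        (∀ (x′ : Fin p) → T (I x′ L) → T (I x′ M) → x′ ≡ x)
    line-size : ∀ (L : Fin l) → pointsOn I L ≡ suc n
    quadrangle : Σ (Fin p) λ a → Σ (Fin p) λ b → Σ (Fin p) λ c → Σ (Fin p) λ d →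
      (a ≢ b × a ≢ c × a ≢ d × b ≢ c × b ≢ d × c ≢ d) ×
      (∀ (L : Fin l) → length (filterᵇ (λ x → I x L) (a ∷ b ∷ c ∷ d ∷ [])) ≤ 2)

-- Subgraphs of the Levi graph Γ_Π (bipartite: points Fin p, lines Fin l).
-- A subgraph is recorded by its vertex set (point part, line part) and
-- its edge set (a Boolean p×l matrix of point-line edges).

Subgraph : ℕ → ℕ → Set
Subgraph p l = Vec Bool p × Vec Bool l × Vec (Vec Bool l) p

subgraph-≟ : ∀ {p l} → DecidableEquality (Subgraph p l)
subgraph-≟ = ProdP.≡-dec (VecP.≡-dec BoolP._≟_)
               (ProdP.≡-dec (VecP.≡-dec BoolP._≟_) (VecP.≡-dec (VecP.≡-dec BoolP._≟_)))

distinctCount : ∀ {p l} → List (Subgraph p l) → ℕ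
distinctCount xs = length (deduplicate subgraph-≟ xs)

allVecs : (q m : ℕ) → List (Vec (Fin q) m)
allVecs q zero = [] ∷ []
allVecs q (suc m) = concatMap (λ x → map (x ∷_) (allVecs q m)) (allFin q)

rot : ∀ {A : Set} {m} → Vec A m → Vec A m
rot [] = []
rot (x ∷ xs) = xs ∷ʳ x

anyFin : (m : ℕ) → (Fin m → Bool) → Bool
anyFin m f = any f (allFin m)

allFinᵇ : (m : ℕ) → (Fin m → Bool) → Bool
allFinᵇ m f = not (anyFin m (λ i → not (f i)))

distinctᵇ : ∀ {q m} → Vec (Fin q) m → Bool
distinctᵇ [] = true
distinctᵇ (x ∷ xs) = not (anyFin _ (λ i → x ==ᶠ lookup xs i)) ∧ distinctᵇ xs

-- A closed sequence P₀ L₀ P₁ L₁ … P_{m-1} L_{m-1} (P₀) is a cycle of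
-- length 2m in Γ_Π iff the P_i are distinct, the L_i are distinct,
-- and P_i, P_{i+1 mod m} both lie on L_i.  (Only meaningful for m ≥ 2.)
isCycleSeq : ∀ {p l m} → Incidence p l → Vec (Fin p) m → Vec (Fin l) m → Bool
isCycleSeq {m = m} I ps ls =
  distinctᵇ ps ∧ distinctᵇ ls ∧
  allFinᵇ m (λ i → I (lookup ps i) (lookup ls i) ∧ I (lookup (rot ps) i) (lookup ls i))

cycleSubgraph : ∀ {p l m} → Vec (Fin p) m → Vec (Fin l) m → Subgraph p l
cycleSubgraph {p} {l} {m} ps ls =
  ( tabulate (λ x → anyFin m (λ i → lookup ps i ==ᶠ x))
  , tabulate (λ L → anyFin m (λ i → lookup ls i ==ᶠ L))
  , tabulate (λ x → tabulate (λ L → anyFin m (λ i →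
        (lookup ls i ==ᶠ L) ∧ ((lookup ps i ==ᶠ x) ∨ (lookup (rot ps) i ==ᶠ x))))) )

allSeqs : (p l m : ℕ) → List (Vec (Fin p) m × Vec (Fin l) m)
allSeqs p l m = concatMap (λ ps → map (λ ls → ps , ls) (allVecs l m)) (allVecs p m)

-- c_{2m}(Γ_Π): number of cycles (as subgraphs) of length 2m
cycleCount : ∀ {p l} → Incidence p l → ℕ → ℕ
cycleCount {p} {l} I m =
  distinctCount (map (λ s → cycleSubgraph (Data.Product.proj₁ s) (Data.Product.proj₂ s))
    (filterᵇ (λ s → isCycleSeq I (Data.Product.proj₁ s) (Data.Product.proj₂ s)) (allSeqs p l m)))

-- A cycle C of length 2m plus a point P ∉ V(C) plus the single edge P — L_j
-- (with P on L_j).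
isPendantData : ∀ {p l m} → Incidence p l →
  Vec (Fin p) m × Vec (Fin l) m → Fin p → Fin m → Bool
isPendantData {m = m} I (ps , ls) P j =
  isCycleSeq I ps ls ∧ not (anyFin m (λ i → lookup ps i ==ᶠ P)) ∧ I P (lookup ls j)

pendantSubgraph : ∀ {p l m} →
  Vec (Fin p) m × Vec (Fin l) m → Fin p → Fin m → Subgraph p l
pendantSubgraph {p} {l} {m} (ps , ls) P j with cycleSubgraph ps ls
... | (vp , vl , es) =
  ( tabulate (λ x → lookup vp x ∨ (P ==ᶠ x))
  , vl
  , tabulate (λ x → tabulate (λ L → lookup (lookup es x) L ∨ ((P ==ᶠ x) ∧ (lookup ls j ==ᶠ L)))) )

allPendantData : (p l m : ℕ) → List ((Vec (Fin p) m × Vec (Fin l) m) × Fin p × Fin m)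
allPendantData p l m =
  concatMap (λ s → concatMap (λ P → map (λ j → s , P , j) (allFin m)) (allFin p)) (allSeqs p l m)

-- |A_k(Γ_Π)| with the cycle length 2m, m = k - 1
pendantCount : ∀ {p l} → Incidence p l → ℕ → ℕ
pendantCount {p} {l} I m =
  distinctCount (map (λ t → pendantSubgraph (Data.Product.proj₁ t)
                               (Data.Product.proj₁ (Data.Product.proj₂ t))
                               (Data.Product.proj₂ (Data.Product.proj₂ t)))
    (filterᵇ (λ t → isPendantData I (Data.Product.proj₁ t)
                      (Data.Product.proj₁ (Data.Product.proj₂ t))
                      (Data.Product.proj₂ (Data.Product.proj₂ t)))
      (allPendantData p l m)))

-- A member of A_k is a cycle C of length 2m (m = k - 1) plus a pendant edge P — L, and it
-- determines the triple (C, L, P): P is its only point vertex of degree one (points of C have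
-- two edges of C), and L is the line at P.  So |A_k| counts the triples with C a cycle, L one
-- of the m lines of C and P a point of L outside C.  A line of C carries at least two points
-- of C (consecutive points of the cycle) and at most m, so it has between (n + 1) - m and
-- n - 1 points outside C.
module Submission where

open import Defs
open import Data.Bool using (Bool; true; false; _∧_; _∨_; not; T; T?)
open import Data.Bool.Properties using (T-∧; T-∨; T-not-≡; ∨-identityʳ)
open import Data.Empty using (⊥-elim)
open import Data.Fin using (Fin; zero; suc; fromℕ; inject₁) renaming (_≟_ to _≟ᶠ_)
open import Data.Fin.Properties using (suc-injective)
open import Data.List using (List; []; _∷_; length; filterᵇ; concatMap; map; _++_; allFin; deduplicate)
open import Data.List.Properties using (length-++; length-++-sucʳ; length-map; length-tabulate)
open import Data.List.Membership.Propositional using (_∈_; find; lose)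
open import Data.List.Membership.Propositional.Properties
  using (∈-∃++; ∈-++⁺ˡ; ∈-++⁺ʳ; ∈-++⁻; ∈-map⁺; ∈-map⁻; ∈-concatMap⁺; ∈-concatMap⁻; ∈-filter⁺; ∈-filter⁻;
         ∈-allFin; ∈-deduplicate⁺; ∈-deduplicate⁻)
open import Data.List.Relation.Binary.Disjoint.Propositional using (Disjoint)
open import Data.List.Relation.Binary.Subset.Propositional using (_⊆_)
open import Data.List.Relation.Unary.Any using (here; there)
open import Data.List.Relation.Unary.Any.Properties using (any⁺; any⁻)
import Data.List.Relation.Unary.All as All
import Data.List.Relation.Unary.All.Properties as Allₚ
import Data.List.Relation.Unary.AllPairs as AllPairs
import Data.List.Relation.Unary.AllPairs.Properties as AllPairsₚ
open import Data.List.Relation.Unary.Unique.Propositional using (Unique; _∷_; [])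
import Data.List.Relation.Unary.Unique.Propositional.Properties as Uniqueₚ
open import Data.List.Relation.Unary.Unique.DecPropositional.Properties using (deduplicate-!)
open import Data.Nat using (ℕ; zero; suc; _+_; _*_; _∸_; _≤_; z≤n; s≤s)
open import Data.Nat.Properties
  using (≤-antisym; ≤-reflexive; +-mono-≤; +-suc; +-comm; *-suc; *-zeroʳ; m+n∸n≡m; +-∸-comm; ∸-monoʳ-≤;
         module ≤-Reasoning)
open import Data.Product using (∃; ∃₂; _×_; _,_; proj₁; proj₂)
import Data.Product as Product
open import Data.Product.Properties using (×-≡,≡→≡)
open import Data.Sum using (_⊎_; inj₁; inj₂; [_,_])
import Data.Sum as Sum
open import Data.Vec using (Vec; []; _∷_; lookup; tabulate; _∷ʳ_)
open import Data.Vec.Properties using (lookup∘tabulate; tabulate∘lookup; tabulate-cong)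
open import Function using (_∘_; id)
open import Function.Bundles using (Equivalence; _⇔_; mk⇔)
open import Relation.Binary.PropositionalEquality hiding ([_])
open import Relation.Nullary using (¬_; yes; no)
open import Relation.Nullary.Decidable using (toWitness; fromWitness; decidable-stable)

open Equivalence using (to; from)

infix 4 _≤_≤_

_≤_≤_ : ℕ → ℕ → ℕ → Set
a ≤ k ≤ b = (a ≤ k) × (k ≤ b)

module _ {A : Set} where

  length-mono-⊆ : ∀ {xs ys : List A} → Unique xs → xs ⊆ ys → length xs ≤ length ys
  length-mono-⊆ {[]} _ _ = z≤n
  length-mono-⊆ {x ∷ xs} (x∉xs ∷ xs!) x∷xs⊆ys with ∈-∃++ (x∷xs⊆ys (here refl))
  ... | as , bs , refl = begin
    suc (length xs)         ≤⟨ s≤s (length-mono-⊆ xs! xs⊆as++bs) ⟩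
    suc (length (as ++ bs)) ≡⟨ length-++-sucʳ as x bs ⟨
    length (as ++ x ∷ bs)   ∎
    where
    open ≤-Reasoning
    xs⊆as++bs : xs ⊆ as ++ bs
    xs⊆as++bs y∈xs with ∈-++⁻ as (x∷xs⊆ys (there y∈xs))
    ... | inj₁ y∈as         = ∈-++⁺ˡ y∈as
    ... | inj₂ (here refl)  = ⊥-elim (All.lookup x∉xs y∈xs refl)
    ... | inj₂ (there y∈bs) = ∈-++⁺ʳ as y∈bs

  length-≡-⊆⊇ : ∀ {xs ys : List A} → Unique xs → Unique ys → xs ⊆ ys → ys ⊆ xs → length xs ≡ length ys
  length-≡-⊆⊇ xs! ys! xs⊆ys ys⊆xs = ≤-antisym (length-mono-⊆ xs! xs⊆ys) (length-mono-⊆ ys! ys⊆xs)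

  length-filterᵇ-split : ∀ (f g : A → Bool) xs →
    length (filterᵇ (λ x → not (g x) ∧ f x) xs) + length (filterᵇ (λ x → g x ∧ f x) xs) ≡ length (filterᵇ f xs)
  length-filterᵇ-split f g [] = refl
  length-filterᵇ-split f g (x ∷ xs) with g x | f x
  ... | true  | true  = trans (+-suc _ _) (cong suc (length-filterᵇ-split f g xs))
  ... | true  | false = length-filterᵇ-split f g xs
  ... | false | true  = cong suc (length-filterᵇ-split f g xs)
  ... | false | false = length-filterᵇ-split f g xs

module _ {A B : Set} where

  map-injectiveOn⁺ : ∀ (f : A → B) {xs} → (∀ {x y} → x ∈ xs → y ∈ xs → f x ≡ f y → x ≡ y) →
    Unique xs → Unique (map f xs)
  map-injectiveOn⁺ f {[]} _ [] = []
  map-injectiveOn⁺ f {x ∷ xs} inj (x∉xs ∷ xs!) =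
    Allₚ.map⁺ (All.tabulate λ y∈xs fx≡fy → All.lookup x∉xs y∈xs (inj (here refl) (there y∈xs) fx≡fy))
    ∷ map-injectiveOn⁺ f (λ x∈xs y∈xs → inj (there x∈xs) (there y∈xs)) xs!

  concatMap⁺ : ∀ (f : A → List B) (key : B → A) → (∀ {x z} → z ∈ f x → key z ≡ x) →
    (∀ x → Unique (f x)) → ∀ {xs} → Unique xs → Unique (concatMap f xs)
  concatMap⁺ f key keyed f! xs! =
    Uniqueₚ.concat⁺ (Allₚ.map⁺ (All.universal f! _)) (AllPairsₚ.map⁺ (AllPairs.map disjoint xs!))
    where
    disjoint : ∀ {x y} → x ≢ y → Disjoint (f x) (f y)
    disjoint x≢y (z∈fx , z∈fy) = x≢y (trans (sym (keyed z∈fx)) (keyed z∈fy))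

  length-concatMap-≥ : ∀ (f : A → List B) a xs → (∀ {x} → x ∈ xs → a ≤ length (f x)) →
    a * length xs ≤ length (concatMap f xs)
  length-concatMap-≥ f a [] _ = ≤-reflexive (*-zeroʳ a)
  length-concatMap-≥ f a (x ∷ xs) bound = begin
    a * suc (length xs)                    ≡⟨ *-suc a (length xs) ⟩
    a + a * length xs                      ≤⟨ +-mono-≤ (bound (here refl)) (length-concatMap-≥ f a xs (bound ∘ there)) ⟩
    length (f x) + length (concatMap f xs) ≡⟨ length-++ (f x) ⟨
    length (concatMap f (x ∷ xs))          ∎
    where open ≤-Reasoning

  length-concatMap-≤ : ∀ (f : A → List B) a xs → (∀ {x} → x ∈ xs → length (f x) ≤ a) →
    length (concatMap f xs) ≤ a * length xs
  length-concatMap-≤ f a [] _ = ≤-reflexive (sym (*-zeroʳ a))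
  length-concatMap-≤ f a (x ∷ xs) bound = begin
    length (concatMap f (x ∷ xs))          ≡⟨ length-++ (f x) ⟩
    length (f x) + length (concatMap f xs) ≤⟨ +-mono-≤ (bound (here refl)) (length-concatMap-≤ f a xs (bound ∘ there)) ⟩
    a + a * length xs                      ≡⟨ *-suc a (length xs) ⟨
    a * suc (length xs)                    ∎
    where open ≤-Reasoning

  length-concatMap-bounds : ∀ (f : A → List B) a b xs → (∀ {x} → x ∈ xs → a ≤ length (f x) ≤ b) →
    a * length xs ≤ length (concatMap f xs) ≤ b * length xs
  length-concatMap-bounds f a b xs bounds =
    length-concatMap-≥ f a xs (proj₁ ∘ bounds) , length-concatMap-≤ f b xs (proj₂ ∘ bounds)

¬T⇒≡false : ∀ {b} → ¬ T b → b ≡ false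
¬T⇒≡false {false} _  = refl
¬T⇒≡false {true}  ¬b = ⊥-elim (¬b _)

∨-cancelʳ-false : ∀ {a b c} → c ≡ false → a ∨ c ≡ b ∨ c → a ≡ b
∨-cancelʳ-false {a} {b} refl a∨false≡b∨false =
  trans (sym (∨-identityʳ a)) (trans a∨false≡b∨false (∨-identityʳ b))

T-==ᶠ : ∀ {q} {x y : Fin q} → T (x ==ᶠ y) ⇔ x ≡ y
T-==ᶠ = mk⇔ toWitness fromWitness

==ᶠ-false : ∀ {q} {x y : Fin q} → x ≢ y → (x ==ᶠ y) ≡ false
==ᶠ-false x≢y = ¬T⇒≡false (x≢y ∘ toWitness)

anyFin⁺ : ∀ {m} (f : Fin m → Bool) i → T (f i) → T (anyFin m f)
anyFin⁺ f i fi = any⁺ f (lose (∈-allFin i) fi)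

anyFin⁻ : ∀ {m} (f : Fin m → Bool) → T (anyFin m f) → ∃ λ i → T (f i)
anyFin⁻ {m} f any-f with find (any⁻ f (allFin m) any-f)
... | i , _ , fi = i , fi

allFinᵇ⁻ : ∀ {m} (f : Fin m → Bool) → T (allFinᵇ m f) → ∀ i → T (f i)
allFinᵇ⁻ f all-f i with f i in fi≡false
... | true  = _
... | false = subst T (to T-not-≡ all-f) (anyFin⁺ (not ∘ f) i (subst (T ∘ not) (sym fi≡false) _))

distinctᵇ⇒lookup-injective : ∀ {q m} (v : Vec (Fin q) m) → T (distinctᵇ v) →
  ∀ {i j} → lookup v i ≡ lookup v j → i ≡ j
distinctᵇ⇒lookup-injective (x ∷ xs) d {zero}  {zero}  _ = refl
distinctᵇ⇒lookup-injective (x ∷ xs) d {zero}  {suc j} x≡xsⱼ =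
  ⊥-elim (subst T (to T-not-≡ (proj₁ (to T-∧ d))) (anyFin⁺ _ j (fromWitness x≡xsⱼ)))
distinctᵇ⇒lookup-injective (x ∷ xs) d {suc i} {zero}  xsᵢ≡x =
  ⊥-elim (subst T (to T-not-≡ (proj₁ (to T-∧ d))) (anyFin⁺ _ i (fromWitness (sym xsᵢ≡x))))
distinctᵇ⇒lookup-injective (x ∷ xs) d {suc i} {suc j} xsᵢ≡xsⱼ =
  cong suc (distinctᵇ⇒lookup-injective xs (proj₂ (to T-∧ d)) xsᵢ≡xsⱼ)

count : ∀ {q} → (Fin q → Bool) → ℕ
count {q} f = length (filterᵇ f (allFin q))

module _ {q m : ℕ} (f : Fin q → Bool) (v : Vec (Fin q) m) where

  count≤ : (∀ {x} → T (f x) → ∃ λ i → lookup v i ≡ x) → count f ≤ m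
  count≤ covered = begin
    count f                            ≤⟨ length-mono-⊆ (Uniqueₚ.filter⁺ (T? ∘ f) (Uniqueₚ.allFin⁺ q)) ⊆image ⟩
    length (map (lookup v) (allFin m)) ≡⟨ length-map (lookup v) (allFin m) ⟩
    length (allFin m)                  ≡⟨ length-tabulate id ⟩
    m                                  ∎
    where
    open ≤-Reasoning
    ⊆image : filterᵇ f (allFin q) ⊆ map (lookup v) (allFin m)
    ⊆image x∈ with covered (proj₂ (∈-filter⁻ (T? ∘ f) {xs = allFin q} x∈))
    ... | i , refl = ∈-map⁺ (lookup v) (∈-allFin i)

  ≤count : (∀ {i j} → lookup v i ≡ lookup v j → i ≡ j) → (∀ i → T (f (lookup v i))) → m ≤ count f
  ≤count v-injective image⊆f = begin
    m                                  ≡⟨ length-tabulate id ⟨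
    length (allFin m)                  ≡⟨ length-map (lookup v) (allFin m) ⟨
    length (map (lookup v) (allFin m)) ≤⟨ length-mono-⊆ (Uniqueₚ.map⁺ v-injective (Uniqueₚ.allFin⁺ m)) image⊆ ⟩
    count f                            ∎
    where
    open ≤-Reasoning
    image⊆ : map (lookup v) (allFin m) ⊆ filterᵇ f (allFin q)
    image⊆ y∈ with ∈-map⁻ (lookup v) y∈
    ... | i , _ , refl = ∈-filter⁺ (T? ∘ f) (∈-allFin (lookup v i)) (image⊆f i)

vec-ext : ∀ {A : Set} {k} {u v : Vec A k} → (∀ i → lookup u i ≡ lookup v i) → u ≡ v
vec-ext {u = u} {v} u≗v = trans (sym (tabulate∘lookup u)) (trans (tabulate-cong u≗v) (tabulate∘lookup v))

lookup-pair-injective : ∀ {A : Set} {a b : A} → a ≢ b →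
  ∀ {i j} → lookup (a ∷ b ∷ []) i ≡ lookup (a ∷ b ∷ []) j → i ≡ j
lookup-pair-injective a≢b {zero}     {zero}     _   = refl
lookup-pair-injective a≢b {zero}     {suc zero} a≡b = ⊥-elim (a≢b a≡b)
lookup-pair-injective a≢b {suc zero} {zero}     b≡a = ⊥-elim (a≢b (sym b≡a))
lookup-pair-injective a≢b {suc zero} {suc zero} _   = refl

fromℕ-or-inject₁ : ∀ {n} (i : Fin (suc n)) → i ≡ fromℕ n ⊎ ∃ λ j → i ≡ inject₁ j
fromℕ-or-inject₁ {zero}  zero    = inj₁ refl
fromℕ-or-inject₁ {suc n} zero    = inj₂ (zero , refl)
fromℕ-or-inject₁ {suc n} (suc i) with fromℕ-or-inject₁ i
... | inj₁ i≡n       = inj₁ (cong suc i≡n)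
... | inj₂ (j , i≡j) = inj₂ (suc j , cong suc i≡j)

inject₁≢suc : ∀ {n} (j : Fin n) → inject₁ j ≢ suc j
inject₁≢suc (suc j) j≡sj = inject₁≢suc j (suc-injective j≡sj)

module _ {A : Set} where

  lookup-∷ʳ-fromℕ : ∀ {n} (xs : Vec A n) x → lookup (xs ∷ʳ x) (fromℕ n) ≡ x
  lookup-∷ʳ-fromℕ []       x = refl
  lookup-∷ʳ-fromℕ (y ∷ xs) x = lookup-∷ʳ-fromℕ xs x

  lookup-∷ʳ-inject₁ : ∀ {n} (xs : Vec A n) x j → lookup (xs ∷ʳ x) (inject₁ j) ≡ lookup xs j
  lookup-∷ʳ-inject₁ (y ∷ xs) x zero    = refl
  lookup-∷ʳ-inject₁ (y ∷ xs) x (suc j) = lookup-∷ʳ-inject₁ xs x j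

  lookup-rot : ∀ {t} (v : Vec A (2 + t)) i → ∃ λ j → j ≢ i × lookup (rot v) i ≡ lookup v j
  lookup-rot (x ∷ xs) i with fromℕ-or-inject₁ i
  ... | inj₁ refl       = zero , (λ ()) , lookup-∷ʳ-fromℕ xs x
  ... | inj₂ (j , refl) = suc j , inject₁≢suc j ∘ sym , lookup-∷ʳ-inject₁ xs x j

  lookup-rot⁻ : ∀ {t} (v : Vec A (2 + t)) j → ∃ λ i → i ≢ j × lookup (rot v) i ≡ lookup v j
  lookup-rot⁻ (x ∷ xs) zero    = fromℕ _ , (λ ()) , lookup-∷ʳ-fromℕ xs x
  lookup-rot⁻ (x ∷ xs) (suc j) = inject₁ j , inject₁≢suc j , lookup-∷ʳ-inject₁ xs x j

module _ {p l : ℕ} where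

  hasPoint : Subgraph p l → Fin p → Bool
  hasPoint (vp , _ , _) = lookup vp

  hasLine : Subgraph p l → Fin l → Bool
  hasLine (_ , vl , _) = lookup vl

  hasEdge : Subgraph p l → Fin p → Fin l → Bool
  hasEdge (_ , _ , es) x = lookup (lookup es x)

  subgraph-ext : ∀ {g h : Subgraph p l} → (∀ x → hasPoint g x ≡ hasPoint h x) →
    (∀ L → hasLine g L ≡ hasLine h L) → (∀ x L → hasEdge g x L ≡ hasEdge h x L) → g ≡ h
  subgraph-ext points lines edges =
    cong₂ _,_ (vec-ext points) (cong₂ _,_ (vec-ext lines) (vec-ext (vec-ext ∘ edges)))

  record PointDegree≥2 (g : Subgraph p l) : Set where
    field
      edge⇒point : ∀ {x L} → T (hasEdge g x L) → T (hasPoint g x)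
      two-edges  : ∀ {x} → T (hasPoint g x) →
        ∃₂ λ L₁ L₂ → L₁ ≢ L₂ × T (hasEdge g x L₁) × T (hasEdge g x L₂)

  open PointDegree≥2

  -- pendantSubgraph (ps , ls) P j is definitionally addPendant (cycleSubgraph ps ls) P (lookup ls j).
  addPendant : Subgraph p l → Fin p → Fin l → Subgraph p l
  addPendant (vp , vl , es) P L =
    ( tabulate (λ x → lookup vp x ∨ (P ==ᶠ x))
    , vl
    , tabulate (λ x → tabulate (λ L′ → lookup (lookup es x) L′ ∨ ((P ==ᶠ x) ∧ (L ==ᶠ L′)))) )

  module _ (g : Subgraph p l) (P : Fin p) (L : Fin l) where

    hasPoint-addPendant : ∀ x → hasPoint (addPendant g P L) x ≡ hasPoint g x ∨ (P ==ᶠ x)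
    hasPoint-addPendant x = lookup∘tabulate _ x

    hasEdge-addPendant : ∀ x L′ →
      hasEdge (addPendant g P L) x L′ ≡ hasEdge g x L′ ∨ ((P ==ᶠ x) ∧ (L ==ᶠ L′))
    hasEdge-addPendant x L′ = trans (cong (λ row → lookup row L′) (lookup∘tabulate _ x)) (lookup∘tabulate _ L′)

    T-hasPoint-addPendant : ∀ {x} → T (hasPoint (addPendant g P L) x) ⇔ (T (hasPoint g x) ⊎ P ≡ x)
    T-hasPoint-addPendant {x} = mk⇔
      (λ t → Sum.map₂ (to T-==ᶠ) (to T-∨ (subst T (hasPoint-addPendant x) t)))
      (λ t → subst T (sym (hasPoint-addPendant x)) (from T-∨ (Sum.map₂ (from T-==ᶠ) t)))

    T-hasEdge-addPendant : ∀ {x L′} →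
      T (hasEdge (addPendant g P L) x L′) ⇔ (T (hasEdge g x L′) ⊎ (P ≡ x × L ≡ L′))
    T-hasEdge-addPendant {x} {L′} = mk⇔
      (λ t → Sum.map₂ (Product.map (to T-==ᶠ) (to T-==ᶠ) ∘ to T-∧)
               (to T-∨ (subst T (hasEdge-addPendant x L′) t)))
      (λ t → subst T (sym (hasEdge-addPendant x L′))
               (from T-∨ (Sum.map₂ (from T-∧ ∘ Product.map (from T-==ᶠ) (from T-==ᶠ)) t)))

  module _ {g : Subgraph p l} (g-deg : PointDegree≥2 g) {P : Fin p} (P∉g : hasPoint g P ≡ false) where

    no-edge-at : ∀ L → hasEdge g P L ≡ false
    no-edge-at L = ¬T⇒≡false (subst T P∉g ∘ edge⇒point g-deg)

    pendant-line : ∀ {L L′} → T (hasEdge (addPendant g P L) P L′) → L ≡ L′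
    pendant-line t = [ ⊥-elim ∘ subst T P∉g ∘ edge⇒point g-deg , proj₂ ] (to (T-hasEdge-addPendant g P _) t)

  module _ {g h : Subgraph p l} (g-deg : PointDegree≥2 g) (h-deg : PointDegree≥2 h) where

    -- If P ≢ P′ then P is a point of h, with two distinct edges in h; but in
    -- addPendant g P L the only edge at P goes to L.
    addPendant-point-injective : ∀ {P P′ L L′} → hasPoint g P ≡ false → hasPoint h P′ ≡ false →
      addPendant g P L ≡ addPendant h P′ L′ → P ≡ P′
    addPendant-point-injective {P} {P′} {L} {L′} P∉g _ same = decidable-stable (P ≟ᶠ P′) P≢P′-absurd
      where
      edge-towards-L : ∀ {L″} → T (hasEdge h P L″) → L ≡ L″
      edge-towards-L e = pendant-line g-deg P∉g
        (subst (λ w → T (hasEdge w P _)) (sym same) (from (T-hasEdge-addPendant h P′ L′) (inj₁ e)))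
      P∈h : P ≢ P′ → T (hasPoint h P)
      P∈h P≢P′ = [ id , ⊥-elim ∘ P≢P′ ∘ sym ] (to (T-hasPoint-addPendant h P′ L′)
        (subst (λ w → T (hasPoint w P)) same (from (T-hasPoint-addPendant g P L) (inj₂ refl))))
      P≢P′-absurd : ¬ P ≢ P′
      P≢P′-absurd P≢P′ with two-edges h-deg (P∈h P≢P′)
      ... | L₁ , L₂ , L₁≢L₂ , e₁ , e₂ = L₁≢L₂ (trans (sym (edge-towards-L e₁)) (edge-towards-L e₂))

    addPendant-cancelʳ : ∀ {P L} → hasPoint g P ≡ false → hasPoint h P ≡ false →
      addPendant g P L ≡ addPendant h P L → g ≡ h
    addPendant-cancelʳ {P} {L} P∉g P∉h same =
      subgraph-ext points (λ L′ → cong (λ w → hasLine w L′) same) edges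
      where
      points : ∀ x → hasPoint g x ≡ hasPoint h x
      points x with P ≟ᶠ x
      ... | yes refl = trans P∉g (sym P∉h)
      ... | no P≢x   = ∨-cancelʳ-false (==ᶠ-false P≢x)
        (trans (sym (hasPoint-addPendant g P L x))
          (trans (cong (λ w → hasPoint w x) same) (hasPoint-addPendant h P L x)))
      edges : ∀ x L′ → hasEdge g x L′ ≡ hasEdge h x L′
      edges x L′ with P ≟ᶠ x
      ... | yes refl = trans (no-edge-at g-deg P∉g L′) (sym (no-edge-at h-deg P∉h L′))
      ... | no P≢x   = ∨-cancelʳ-false (cong (_∧ (L ==ᶠ L′)) (==ᶠ-false P≢x))
        (trans (sym (hasEdge-addPendant g P L x L′))
          (trans (cong (λ w → hasEdge w x L′) same) (hasEdge-addPendant h P L x L′)))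

    addPendant-injective : ∀ {P P′ L L′} → hasPoint g P ≡ false → hasPoint h P′ ≡ false →
      addPendant g P L ≡ addPendant h P′ L′ → g ≡ h × P ≡ P′ × L ≡ L′
    addPendant-injective {P} {P′} {L} {L′} P∉g P′∉h same
      with refl ← addPendant-point-injective P∉g P′∉h same
      with refl ← pendant-line h-deg P′∉h
                    (subst (λ w → T (hasEdge w P L)) same (from (T-hasEdge-addPendant g P L) (inj₂ (refl , refl))))
      = addPendant-cancelʳ P∉g P′∉h same , refl , refl

module _ {p l m : ℕ} (ps : Vec (Fin p) m) (ls : Vec (Fin l) m) where

  hasPoint-cycleSubgraph : ∀ x → hasPoint (cycleSubgraph ps ls) x ≡ anyFin m (λ i → lookup ps i ==ᶠ x)
  hasPoint-cycleSubgraph x = lookup∘tabulate _ x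

  hasLine-cycleSubgraph : ∀ L → hasLine (cycleSubgraph ps ls) L ≡ anyFin m (λ i → lookup ls i ==ᶠ L)
  hasLine-cycleSubgraph L = lookup∘tabulate _ L

  hasEdge-cycleSubgraph : ∀ x L → hasEdge (cycleSubgraph ps ls) x L
    ≡ anyFin m (λ i → (lookup ls i ==ᶠ L) ∧ ((lookup ps i ==ᶠ x) ∨ (lookup (rot ps) i ==ᶠ x)))
  hasEdge-cycleSubgraph x L = trans (cong (λ row → lookup row L) (lookup∘tabulate _ x)) (lookup∘tabulate _ L)

  cycleSubgraph-point⁻ : ∀ {x} → T (hasPoint (cycleSubgraph ps ls) x) → ∃ λ i → lookup ps i ≡ x
  cycleSubgraph-point⁻ {x} t with anyFin⁻ _ (subst T (hasPoint-cycleSubgraph x) t)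
  ... | i , psᵢ≡x = i , to T-==ᶠ psᵢ≡x

  cycleSubgraph-point⁺ : ∀ i → T (hasPoint (cycleSubgraph ps ls) (lookup ps i))
  cycleSubgraph-point⁺ i = subst T (sym (hasPoint-cycleSubgraph _)) (anyFin⁺ _ i (from T-==ᶠ refl))

  cycleSubgraph-line⁻ : ∀ {L} → T (hasLine (cycleSubgraph ps ls) L) → ∃ λ i → lookup ls i ≡ L
  cycleSubgraph-line⁻ {L} t with anyFin⁻ _ (subst T (hasLine-cycleSubgraph L) t)
  ... | i , lsᵢ≡L = i , to T-==ᶠ lsᵢ≡L

  cycleSubgraph-line⁺ : ∀ i → T (hasLine (cycleSubgraph ps ls) (lookup ls i))
  cycleSubgraph-line⁺ i = subst T (sym (hasLine-cycleSubgraph _)) (anyFin⁺ _ i (from T-==ᶠ refl))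

  cycleSubgraph-edge⁻ : ∀ {x L} → T (hasEdge (cycleSubgraph ps ls) x L) →
    ∃ λ i → lookup ls i ≡ L × (lookup ps i ≡ x ⊎ lookup (rot ps) i ≡ x)
  cycleSubgraph-edge⁻ {x} {L} t with anyFin⁻ _ (subst T (hasEdge-cycleSubgraph x L) t)
  ... | i , eᵢ with to T-∧ eᵢ
  ... | lsᵢ≡L , ends = i , to T-==ᶠ lsᵢ≡L , Sum.map (to T-==ᶠ) (to T-==ᶠ) (to T-∨ ends)

  cycleSubgraph-edge⁺ : ∀ {x} i → lookup ps i ≡ x ⊎ lookup (rot ps) i ≡ x →
    T (hasEdge (cycleSubgraph ps ls) x (lookup ls i))
  cycleSubgraph-edge⁺ {x} i ends = subst T (sym (hasEdge-cycleSubgraph x _))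
    (anyFin⁺ _ i (from T-∧ (from T-==ᶠ refl , from T-∨ (Sum.map (from T-==ᶠ) (from T-==ᶠ) ends))))

T-isPendantData : ∀ {p l m} (I : Incidence p l) (ps : Vec (Fin p) m) (ls : Vec (Fin l) m) {P j} →
  T (isPendantData I (ps , ls) P j) ⇔
  (T (isCycleSeq I ps ls) × T (not (hasPoint (cycleSubgraph ps ls) P) ∧ I P (lookup ls j)))
T-isPendantData I ps ls {P} = mk⇔
  (Product.map₂ (subst (λ b → T (not b ∧ _)) (sym (hasPoint-cycleSubgraph ps ls P))) ∘ to T-∧)
  (from T-∧ ∘ Product.map₂ (subst (λ b → T (not b ∧ _)) (hasPoint-cycleSubgraph ps ls P)))

module CycleSeq {p l t : ℕ} (I : Incidence p l) (ps : Vec (Fin p) (2 + t)) (ls : Vec (Fin l) (2 + t))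
                (cycle : T (isCycleSeq I ps ls)) where

  private
    C : Subgraph p l
    C = cycleSubgraph ps ls

    parts : T (distinctᵇ ps) × T (distinctᵇ ls) ×
      (∀ i → T (I (lookup ps i) (lookup ls i) ∧ I (lookup (rot ps) i) (lookup ls i)))
    parts = Product.map₂ (Product.map₂ (allFinᵇ⁻ _) ∘ to T-∧) (to T-∧ cycle)

  ps-injective : ∀ {i j} → lookup ps i ≡ lookup ps j → i ≡ j
  ps-injective = distinctᵇ⇒lookup-injective ps (proj₁ parts)

  ls-injective : ∀ {i j} → lookup ls i ≡ lookup ls j → i ≡ j
  ls-injective = distinctᵇ⇒lookup-injective ls (proj₁ (proj₂ parts))

  incident : ∀ i → T (I (lookup ps i) (lookup ls i)) × T (I (lookup (rot ps) i) (lookup ls i))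
  incident i = to T-∧ (proj₂ (proj₂ parts) i)

  pointDegree≥2 : PointDegree≥2 C
  pointDegree≥2 = record { edge⇒point = endpoint ; two-edges = two-lines }
    where
    endpoint : ∀ {x L} → T (hasEdge C x L) → T (hasPoint C x)
    endpoint e with cycleSubgraph-edge⁻ ps ls e
    ... | i , _ , inj₁ refl = cycleSubgraph-point⁺ ps ls i
    ... | i , _ , inj₂ refl with lookup-rot ps i
    ...   | j , _ , rotᵢ≡psⱼ = subst (T ∘ hasPoint C) (sym rotᵢ≡psⱼ) (cycleSubgraph-point⁺ ps ls j)
    two-lines : ∀ {x} → T (hasPoint C x) → ∃₂ λ L₁ L₂ → L₁ ≢ L₂ × T (hasEdge C x L₁) × T (hasEdge C x L₂)
    two-lines t with cycleSubgraph-point⁻ ps ls t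
    ... | i , refl with lookup-rot⁻ ps i
    ... | i′ , i′≢i , rotᵢ′≡psᵢ =
      lookup ls i , lookup ls i′ , i′≢i ∘ sym ∘ ls-injective ,
      cycleSubgraph-edge⁺ ps ls i (inj₁ refl) , cycleSubgraph-edge⁺ ps ls i′ (inj₂ rotᵢ′≡psᵢ)

  count-lines : count (hasLine C) ≡ 2 + t
  count-lines = ≤-antisym (count≤ _ ls (cycleSubgraph-line⁻ ps ls))
                          (≤count _ ls ls-injective (cycleSubgraph-line⁺ ps ls))

  count-points-on-≤ : ∀ L → count (λ x → hasPoint C x ∧ I x L) ≤ 2 + t
  count-points-on-≤ L = count≤ _ ps (cycleSubgraph-point⁻ ps ls ∘ proj₁ ∘ to T-∧)

  -- The line L j of the cycle carries the consecutive points P j and P (j + 1).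
  count-points-on-≥ : ∀ {L} → T (hasLine C L) → 2 ≤ count (λ x → hasPoint C x ∧ I x L)
  count-points-on-≥ t with cycleSubgraph-line⁻ ps ls t
  ... | j , refl with lookup-rot ps j
  ... | j′ , j′≢j , rotⱼ≡psⱼ′ =
    ≤count _ (lookup ps j ∷ lookup (rot ps) j ∷ []) (lookup-pair-injective psⱼ≢rotⱼ) on-line
    where
    psⱼ≢rotⱼ : lookup ps j ≢ lookup (rot ps) j
    psⱼ≢rotⱼ e = j′≢j (sym (ps-injective (trans e rotⱼ≡psⱼ′)))
    on-line : ∀ i → T (hasPoint C (lookup (lookup ps j ∷ lookup (rot ps) j ∷ []) i) ∧ I _ (lookup ls j))
    on-line zero       = from T-∧ (cycleSubgraph-point⁺ ps ls j , proj₁ (incident j))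
    on-line (suc zero) = from T-∧ ( subst (T ∘ hasPoint C) (sym rotⱼ≡psⱼ′) (cycleSubgraph-point⁺ ps ls j′)
                                   , proj₂ (incident j))

∈-allVecs : ∀ q m (v : Vec (Fin q) m) → v ∈ allVecs q m
∈-allVecs q zero    []      = here refl
∈-allVecs q (suc m) (x ∷ v) = ∈-concatMap⁺ _ (lose (∈-allFin x) (∈-map⁺ (x ∷_) (∈-allVecs q m v)))

∈-allSeqs : ∀ {p l m} (ps : Vec (Fin p) m) (ls : Vec (Fin l) m) → (ps , ls) ∈ allSeqs p l m
∈-allSeqs {p} {l} {m} ps ls = ∈-concatMap⁺ _ (lose (∈-allVecs p m ps) (∈-map⁺ (ps ,_) (∈-allVecs l m ls)))

∈-allPendantData : ∀ {p l m} s (P : Fin p) (j : Fin m) → (s , P , j) ∈ allPendantData p l m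
∈-allPendantData (ps , ls) P j =
  ∈-concatMap⁺ _ (lose (∈-allSeqs ps ls) (∈-concatMap⁺ _ (lose (∈-allFin P) (∈-map⁺ _ (∈-allFin j)))))

module PendantCounting {p l : ℕ} (I : Incidence p l) (t : ℕ) where

  cycles : List (Subgraph p l)
  cycles = deduplicate subgraph-≟ (map (λ s → cycleSubgraph (proj₁ s) (proj₂ s))
    (filterᵇ (λ s → isCycleSeq I (proj₁ s) (proj₂ s)) (allSeqs p l (2 + t))))

  pendants : List (Subgraph p l)
  pendants = deduplicate subgraph-≟ (map (λ u → pendantSubgraph (proj₁ u) (proj₁ (proj₂ u)) (proj₂ (proj₂ u)))
    (filterᵇ (λ u → isPendantData I (proj₁ u) (proj₁ (proj₂ u)) (proj₂ (proj₂ u))) (allPendantData p l (2 + t))))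

  cycles-unique : Unique cycles
  cycles-unique = deduplicate-! subgraph-≟ _

  cycles-elim : ∀ (P : Subgraph p l → Set) →
    (∀ ps ls → T (isCycleSeq I ps ls) → P (cycleSubgraph ps ls)) → ∀ {g} → g ∈ cycles → P g
  cycles-elim P on-cycle g∈ with ∈-map⁻ _ (∈-deduplicate⁻ subgraph-≟ _ g∈)
  ... | (ps , ls) , s∈ , refl = on-cycle ps ls (proj₂ (∈-filter⁻ (T? ∘ _) {xs = allSeqs p l (2 + t)} s∈))

  cycles⁺ : ∀ ps ls → T (isCycleSeq I ps ls) → cycleSubgraph ps ls ∈ cycles
  cycles⁺ ps ls cycle = ∈-deduplicate⁺ subgraph-≟ (∈-map⁺ _ (∈-filter⁺ (T? ∘ _) (∈-allSeqs ps ls) cycle))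

  pendants⁺ : ∀ (ps : Vec (Fin p) (2 + t)) (ls : Vec (Fin l) (2 + t)) P j →
    T (isPendantData I (ps , ls) P j) → pendantSubgraph (ps , ls) P j ∈ pendants
  pendants⁺ ps ls P j pendant =
    ∈-deduplicate⁺ subgraph-≟ (∈-map⁺ _ (∈-filter⁺ (T? ∘ _) (∈-allPendantData (ps , ls) P j) pendant))

  cycles-pointDegree≥2 : ∀ {g} → g ∈ cycles → PointDegree≥2 g
  cycles-pointDegree≥2 = cycles-elim PointDegree≥2 (CycleSeq.pointDegree≥2 I)

  linesOf : Subgraph p l → List (Fin l)
  linesOf g = filterᵇ (hasLine g) (allFin l)

  outside : Subgraph p l → Fin l → List (Fin p)
  outside g L = filterᵇ (λ x → not (hasPoint g x) ∧ I x L) (allFin p)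

  Attachment : Set
  Attachment = Subgraph p l × Fin p × Fin l

  attach : Attachment → Subgraph p l
  attach (g , x , L) = addPendant g x L

  attachmentsAlong : Subgraph p l → Fin l → List Attachment
  attachmentsAlong g L = map (λ x → g , x , L) (outside g L)

  attachmentsTo : Subgraph p l → List Attachment
  attachmentsTo g = concatMap (attachmentsAlong g) (linesOf g)

  attachments : List Attachment
  attachments = concatMap attachmentsTo cycles

  ∈-attachmentsTo⁻ : ∀ {g g′ x L} → (g′ , x , L) ∈ attachmentsTo g →
    g′ ≡ g × T (hasLine g L) × T (not (hasPoint g x) ∧ I x L)
  ∈-attachmentsTo⁻ {g} a∈ with find (∈-concatMap⁻ _ {xs = linesOf g} a∈)
  ... | L , L∈ , a∈ₗ with ∈-map⁻ _ a∈ₗ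
  ... | x , x∈ , refl =
    refl , proj₂ (∈-filter⁻ (T? ∘ hasLine g) {xs = allFin l} L∈) , proj₂ (∈-filter⁻ (T? ∘ _) {xs = allFin p} x∈)

  ∈-attachments⁻ : ∀ {g x L} → (g , x , L) ∈ attachments →
    g ∈ cycles × T (hasLine g L) × T (not (hasPoint g x) ∧ I x L)
  ∈-attachments⁻ a∈ with find (∈-concatMap⁻ attachmentsTo {xs = cycles} a∈)
  ... | g , g∈ , a∈g with ∈-attachmentsTo⁻ a∈g
  ... | refl , on-line = g∈ , on-line

  ∈-attachments⁺ : ∀ {g x L} → g ∈ cycles → T (hasLine g L) → T (not (hasPoint g x) ∧ I x L) →
    (g , x , L) ∈ attachments
  ∈-attachments⁺ {g} {x} {L} g∈ L∈g x∉g∧x∈L = ∈-concatMap⁺ attachmentsTo (lose g∈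
    (∈-concatMap⁺ _ (lose (∈-filter⁺ (T? ∘ hasLine g) (∈-allFin L) L∈g)
      (∈-map⁺ _ (∈-filter⁺ (T? ∘ _) (∈-allFin x) x∉g∧x∈L)))))

  attachments-unique : Unique attachments
  attachments-unique =
    concatMap⁺ attachmentsTo proj₁ (proj₁ ∘ ∈-attachmentsTo⁻) attachmentsTo-unique cycles-unique
    where
    attachmentsTo-unique : ∀ g → Unique (attachmentsTo g)
    attachmentsTo-unique g = concatMap⁺ (attachmentsAlong g) (proj₂ ∘ proj₂) line-key
      (λ L → Uniqueₚ.map⁺ (cong (proj₁ ∘ proj₂)) (Uniqueₚ.filter⁺ (T? ∘ _) (Uniqueₚ.allFin⁺ p)))
      (Uniqueₚ.filter⁺ (T? ∘ hasLine g) (Uniqueₚ.allFin⁺ l))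
      where
      line-key : ∀ {L a} → a ∈ attachmentsAlong g L → proj₂ (proj₂ a) ≡ L
      line-key a∈ with ∈-map⁻ _ a∈
      ... | _ , _ , refl = refl

  ∈-attachments-pointDegree≥2 : ∀ {g x L} → (g , x , L) ∈ attachments → PointDegree≥2 g
  ∈-attachments-pointDegree≥2 a∈ = cycles-pointDegree≥2 (proj₁ (∈-attachments⁻ a∈))

  ∈-attachments-new-point : ∀ {g x L} → (g , x , L) ∈ attachments → hasPoint g x ≡ false
  ∈-attachments-new-point a∈ = to T-not-≡ (proj₁ (to T-∧ (proj₂ (proj₂ (∈-attachments⁻ a∈)))))

  attach-injective : ∀ {a b} → a ∈ attachments → b ∈ attachments → attach a ≡ attach b → a ≡ b
  attach-injective a∈ b∈ same = ×-≡,≡→≡ (Product.map₂ ×-≡,≡→≡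
    (addPendant-injective (∈-attachments-pointDegree≥2 a∈) (∈-attachments-pointDegree≥2 b∈)
      (∈-attachments-new-point a∈) (∈-attachments-new-point b∈) same))

  pendant⇒attachment : ∀ (ps : Vec (Fin p) (2 + t)) (ls : Vec (Fin l) (2 + t)) {P j} →
    T (isPendantData I (ps , ls) P j) → (cycleSubgraph ps ls , P , lookup ls j) ∈ attachments
  pendant⇒attachment ps ls {j = j} pendant with to (T-isPendantData I ps ls) pendant
  ... | cycle , P∉C∧P∈Lⱼ = ∈-attachments⁺ (cycles⁺ ps ls cycle) (cycleSubgraph-line⁺ ps ls j) P∉C∧P∈Lⱼ

  cycle-attachment⇒pendant : ∀ {x L} (ps : Vec (Fin p) (2 + t)) (ls : Vec (Fin l) (2 + t)) →
    T (isCycleSeq I ps ls) → T (hasLine (cycleSubgraph ps ls) L) →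
    T (not (hasPoint (cycleSubgraph ps ls) x) ∧ I x L) → addPendant (cycleSubgraph ps ls) x L ∈ pendants
  cycle-attachment⇒pendant ps ls cycle L∈C x∉C∧x∈L with cycleSubgraph-line⁻ ps ls L∈C
  ... | j , refl = pendants⁺ ps ls _ j (from (T-isPendantData I ps ls) (cycle , x∉C∧x∈L))

  attachment⇒pendant : ∀ {g x L} → (g , x , L) ∈ attachments → addPendant g x L ∈ pendants
  attachment⇒pendant {g} {x} {L} a∈ =
    let g∈ , L∈g , x∉g∧x∈L = ∈-attachments⁻ a∈
    in cycles-elim (λ h → T (hasLine h L) → T (not (hasPoint h x) ∧ I x L) → addPendant h x L ∈ pendants)
         cycle-attachment⇒pendant g∈ L∈g x∉g∧x∈L

  length-pendants : length pendants ≡ length attachments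
  length-pendants = trans
    (length-≡-⊆⊇ (deduplicate-! subgraph-≟ _) (map-injectiveOn⁺ attach attach-injective attachments-unique)
      pendants⊆ ⊆pendants)
    (length-map attach attachments)
    where
    pendants⊆ : pendants ⊆ map attach attachments
    pendants⊆ w∈ with ∈-map⁻ _ (∈-deduplicate⁻ subgraph-≟ _ w∈)
    ... | ((ps , ls) , P , j) , u∈ , refl =
      ∈-map⁺ attach (pendant⇒attachment ps ls (proj₂ (∈-filter⁻ (T? ∘ _) {xs = allPendantData p l (2 + t)} u∈)))
    ⊆pendants : map attach attachments ⊆ pendants
    ⊆pendants w∈ with ∈-map⁻ attach w∈
    ... | _ , a∈ , refl = attachment⇒pendant a∈

  module Bounds {n : ℕ} (line-size : ∀ L → pointsOn I L ≡ suc n) where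

    module _ (ps : Vec (Fin p) (2 + t)) (ls : Vec (Fin l) (2 + t)) (cycle : T (isCycleSeq I ps ls)) where
      open CycleSeq I ps ls cycle

      private
        C : Subgraph p l
        C = cycleSubgraph ps ls

      length-outside : ∀ L → length (outside C L) ≡ suc n ∸ count (λ x → hasPoint C x ∧ I x L)
      length-outside L = begin
        length (outside C L)               ≡⟨ m+n∸n≡m _ on-C ⟨
        length (outside C L) + on-C ∸ on-C ≡⟨ cong (_∸ on-C) (length-filterᵇ-split (λ x → I x L) (hasPoint C) (allFin p)) ⟩
        pointsOn I L ∸ on-C                ≡⟨ cong (_∸ on-C) (line-size L) ⟩
        suc n ∸ on-C                       ∎
        where
        open ≡-Reasoning
        on-C : ℕ
        on-C = count (λ x → hasPoint C x ∧ I x L)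

      length-outside-bounds : ∀ {L} → T (hasLine C L) → suc n ∸ (2 + t) ≤ length (outside C L) ≤ n ∸ 1
      length-outside-bounds {L} L∈C rewrite length-outside L =
        ∸-monoʳ-≤ (suc n) (count-points-on-≤ L) , ∸-monoʳ-≤ (suc n) (count-points-on-≥ L∈C)

      length-attachmentsAlong-bounds : ∀ {L} → L ∈ linesOf C →
        suc n ∸ (2 + t) ≤ length (attachmentsAlong C L) ≤ n ∸ 1
      length-attachmentsAlong-bounds {L} L∈ =
        subst (λ k → suc n ∸ (2 + t) ≤ k ≤ n ∸ 1) (sym (length-map (λ x → C , x , L) (outside C L)))
          (length-outside-bounds (proj₂ (∈-filter⁻ (T? ∘ hasLine C) {xs = allFin l} L∈)))

      length-attachmentsTo-cycleSubgraph :
        (suc n ∸ (2 + t)) * (2 + t) ≤ length (attachmentsTo C) ≤ (n ∸ 1) * (2 + t)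
      length-attachmentsTo-cycleSubgraph =
        subst (λ k → (suc n ∸ (2 + t)) * k ≤ length (attachmentsTo C) ≤ (n ∸ 1) * k) count-lines
          (length-concatMap-bounds (attachmentsAlong C) _ _ (linesOf C) length-attachmentsAlong-bounds)

    length-attachmentsTo : ∀ {g} → g ∈ cycles →
      (suc n ∸ (2 + t)) * (2 + t) ≤ length (attachmentsTo g) ≤ (n ∸ 1) * (2 + t)
    length-attachmentsTo = cycles-elim
      (λ g → (suc n ∸ (2 + t)) * (2 + t) ≤ length (attachmentsTo g) ≤ (n ∸ 1) * (2 + t))
      length-attachmentsTo-cycleSubgraph

    pendantCount-bounds : (suc n ∸ (2 + t)) * (2 + t) * cycleCount I (2 + t)
                        ≤ pendantCount I (2 + t)
                        ≤ (n ∸ 1) * (2 + t) * cycleCount I (2 + t)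
    pendantCount-bounds =
      subst (λ k → (suc n ∸ (2 + t)) * (2 + t) * length cycles ≤ k ≤ (n ∸ 1) * (2 + t) * length cycles)
        (sym length-pendants) (length-concatMap-bounds attachmentsTo _ _ cycles length-attachmentsTo)

n∸[1+k]+2≡1+n∸k : ∀ {n k} → suc k ≤ n → n ∸ suc k + 2 ≡ suc n ∸ k
n∸[1+k]+2≡1+n∸k {n} {k} 1+k≤n = trans (sym (+-∸-comm 2 1+k≤n)) (cong (_∸ suc k) (+-comm n 2))

lemma4 : ∀ {p l : ℕ} (n k : ℕ) (I : Incidence p l) → IsProjectivePlane n I →
    4 ≤ k → k ≤ n →
    ((n ∸ k + 2) * (k ∸ 1) * cycleCount I (k ∸ 1) ≤ pendantCount I (k ∸ 1))
    × (pendantCount I (k ∸ 1) ≤ (n ∸ 1) * (k ∸ 1) * cycleCount I (k ∸ 1))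
lemma4 n k@(suc (suc (suc (suc r)))) I plane (s≤s (s≤s (s≤s (s≤s z≤n)))) k≤n =
  Product.map₁ (subst (λ a → a * (k ∸ 1) * cycleCount I (k ∸ 1) ≤ pendantCount I (k ∸ 1))
                      (sym (n∸[1+k]+2≡1+n∸k k≤n)))
    pendantCount-bounds
  where open PendantCounting.Bounds I (suc r) (IsProjectivePlane.line-size plane)
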